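{- Let $H$ be an $n$-vertex $3$-graph with $n\ge 8$ and $\delta_2(H)\ge 3$. Then for every vertex $u$ of $H$ there are six distinct vertices $v_1,\dots,v_6$, all different from $u$, such that $\{u,v_1,v_2\},\{u,v_3,v_4\},\{v_4,v_5,v_6\}$ are edges of $H$ (a linear $3$-path in which $u$ is the intersection of the first two edges).
   Context: $\delta_2(H)$ is the minimum over pairs of vertices of the number of edges containing the pair. -}

module Defs where

open import Data.Nat using (ℕ; _≥_)
open import Data.Fin using (Fin)
open import Data.Fin.Subset using (Subset; ∣_∣; _∈_; ⁅_⁆; _∪_)
open import Data.Fin.Subset.Properties using (_∈?_)
open import Data.List using (List; length; filter)
open import Data.List.Relation.Unary.All using (All)
open import Data.List.Relation.Unary.Unique.Propositional using (Unique)
import Data.List.Membership.Propositional as L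
open import Data.Product using (_×_; _,_)
open import Relation.Nullary.Decidable using (_×-dec_)
open import Relation.Binary.PropositionalEquality using (_≡_; _≢_)

record ThreeGraph (n : ℕ) : Set where
  field
    edges    : List (Subset n)
    unique   : Unique edges
    uniform  : All (λ e → ∣ e ∣ ≡ 3) edges
open ThreeGraph public

pairDeg : ∀ {n} → ThreeGraph n → Fin n → Fin n → ℕ
pairDeg H x y = length (filter (λ e → (x ∈? e) ×-dec (y ∈? e)) (edges H))

δ₂≥ : ∀ {n} → ThreeGraph n → ℕ → Set
δ₂≥ H k = ∀ x y → x ≢ y → pairDeg H x y ≥ k

triple : ∀ {n} → Fin n → Fin n → Fin n → Subset n
triple a b c = ⁅ a ⁆ ∪ (⁅ b ⁆ ∪ ⁅ c ⁆)

IsEdge : ∀ {n} → ThreeGraph n → Fin n → Fin n → Fin n → Set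
IsEdge H a b c = triple a b c L.∈ edges H

{-# OPTIONS --safe #-}
module Submission where

-- Fix a linear 2-path {u,d,a}, {a,b,c} on five distinct vertices and three further vertices
-- e₁, e₂, e₃. If the link of {u,e₁} or of {u,e₃} contains a vertex t outside {a,b,c,d}, the
-- edge {u,eᵢ,t} completes the path. Otherwise both links lie in {a,b,c,d}: take an edge
-- {e₁,e₂,t} with t ∉ {u,e₃}, then x ≠ t in the link of {u,e₁} and y ∉ {t,x} in the link of
-- {u,e₃}; the path {u,e₃,y}, {u,x,e₁}, {e₁,e₂,t} works. Each choice avoids at most two
-- vertices among the three edges through a pair (this is δ₂ ≥ 3), and n ≥ 8 leaves room for
-- the three fresh vertices.

open import Defs
open import Data.Nat using (ℕ; suc; _≥_; _≤_; _<_; s≤s)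
open import Data.Nat.Properties using (suc-injective; ≤-trans; m≤m+n)
open import Data.Fin using (Fin; zero; suc; _≟_)
open import Data.Fin.Properties using (pigeonhole; ¬∀⟶∃¬; <⇒≢)
open import Data.Fin.Subset using (Subset; ∣_∣; ⁅_⁆; _∪_; _─_; _-_; ⊥; inside; outside)
open import Data.Fin.Subset.Properties
  using (∪-identityˡ; ∪-comm; p─⊥≡p; x∈⁅x⁆; p─q⊆p; x∈p∧x≢y⇒x∈p-y)
  renaming (_∈?_ to _∈ₛ?_)
open import Data.List using (List; _∷_; length; filter)
import Data.List.Relation.Unary.Any as ListAny
import Data.List.Relation.Unary.All as ListAll
open import Data.List.Relation.Unary.All using (_∷_)
open import Data.List.Relation.Unary.AllPairs using (_∷_)
import Data.List.Membership.Propositional as List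
open import Data.List.Membership.Propositional.Properties using (∈-filter⁻)
import Data.List.Relation.Unary.Unique.Propositional as List
open import Data.List.Relation.Unary.Unique.Propositional.Properties using (filter⁺)
open import Data.Vec using (Vec; []; _∷_; here; there; lookup)
open import Data.Vec.Relation.Unary.All as All using (All; []; _∷_)
open import Data.Vec.Relation.Unary.All.Properties using (lookup⁻)
import Data.Vec.Relation.Unary.Any as Any
open import Data.Vec.Relation.Unary.Any.Properties using (lookup-index)
open import Data.Vec.Relation.Unary.AllPairs using ([]; _∷_)
open import Data.Vec.Relation.Unary.Unique.Propositional using (Unique)
open import Data.Vec.Membership.Propositional.Properties using (∈-lookup)
open import Data.Product using (Σ; ∃; _×_; _,_)
open import Data.Sum using (_⊎_; inj₁; inj₂)
open import Relation.Nullary using (¬_; yes; no)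
open import Relation.Nullary.Decidable using (_×-dec_)
open import Relation.Unary using (Decidable)
open import Relation.Binary.Definitions using (DecidableEquality)
open import Relation.Binary.PropositionalEquality
  using (_≡_; _≢_; refl; sym; trans; cong; subst; ≢-sym; module ≡-Reasoning)

module _ where
  open import Data.Fin.Subset using (_∈_; _∉_)

  ∣p∣≡0⇒p≡⊥ : ∀ {n} {p : Subset n} → ∣ p ∣ ≡ 0 → p ≡ ⊥
  ∣p∣≡0⇒p≡⊥ {p = []}          _ = refl
  ∣p∣≡0⇒p≡⊥ {p = outside ∷ p} e = cong (outside ∷_) (∣p∣≡0⇒p≡⊥ e)

  ∣p∣≡1⇒p≡⁅x⁆ : ∀ {n} {p : Subset n} → ∣ p ∣ ≡ 1 → ∃ λ x → p ≡ ⁅ x ⁆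
  ∣p∣≡1⇒p≡⁅x⁆ {p = inside ∷ p}  e = zero , cong (inside ∷_) (∣p∣≡0⇒p≡⊥ (suc-injective e))
  ∣p∣≡1⇒p≡⁅x⁆ {p = outside ∷ p} e with x , p≡⁅x⁆ ← ∣p∣≡1⇒p≡⁅x⁆ e = suc x , cong (outside ∷_) p≡⁅x⁆

  x∉p-x : ∀ {n} {p : Subset n} {x} → x ∉ p - x
  x∉p-x {p = _ ∷ p} {suc x} (there x∈p-x) = x∉p-x {p = p} x∈p-x

  x∈p⇒∣p∣≡1+∣p-x∣ : ∀ {n} {p : Subset n} {x} → x ∈ p → ∣ p ∣ ≡ suc ∣ p - x ∣
  x∈p⇒∣p∣≡1+∣p-x∣ {p = inside ∷ p}  here       = cong (λ q → suc ∣ q ∣) (sym (p─⊥≡p p))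
  x∈p⇒∣p∣≡1+∣p-x∣ {p = inside ∷ p}  (there x∈p) = cong suc (x∈p⇒∣p∣≡1+∣p-x∣ x∈p)
  x∈p⇒∣p∣≡1+∣p-x∣ {p = outside ∷ p} (there x∈p) = x∈p⇒∣p∣≡1+∣p-x∣ x∈p

  x∈p⇒p≡⁅x⁆∪p-x : ∀ {n} {p : Subset n} {x} → x ∈ p → p ≡ ⁅ x ⁆ ∪ (p - x)
  x∈p⇒p≡⁅x⁆∪p-x {p = inside ∷ p} here =
    cong (inside ∷_) (sym (trans (∪-identityˡ (p ─ ⊥)) (p─⊥≡p p)))
  x∈p⇒p≡⁅x⁆∪p-x {p = s ∷ p} (there x∈p) = cong (s ∷_) (x∈p⇒p≡⁅x⁆∪p-x x∈p)

  module _ {n} {p : Subset n} {x y : Fin n} (x∈p : x ∈ p) (y∈p : y ∈ p) (x≢y : x ≢ y) where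

    private
      y∈p-x : y ∈ p - x
      y∈p-x = x∈p∧x≢y⇒x∈p-y y∈p (≢-sym x≢y)

    p-x-y≡⁅t⁆⇒p≡triple : ∀ {t} → p - x - y ≡ ⁅ t ⁆ → t ≢ x × t ≢ y × p ≡ triple x y t
    p-x-y≡⁅t⁆⇒p≡triple {t} p-x-y≡⁅t⁆ = t≢x , t≢y , p≡xyt
      where
      t∈p-x-y : t ∈ p - x - y
      t∈p-x-y = subst (t ∈_) (sym p-x-y≡⁅t⁆) (x∈⁅x⁆ t)
      t≢x : t ≢ x
      t≢x refl = x∉p-x {p = p} (p─q⊆p (p - t) ⁅ y ⁆ t∈p-x-y)
      t≢y : t ≢ y
      t≢y refl = x∉p-x {p = p - x} t∈p-x-y
      p≡xyt : p ≡ triple x y t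
      p≡xyt = trans (x∈p⇒p≡⁅x⁆∪p-x x∈p)
                    (cong (⁅ x ⁆ ∪_) (trans (x∈p⇒p≡⁅x⁆∪p-x y∈p-x) (cong (⁅ y ⁆ ∪_) p-x-y≡⁅t⁆)))

    ∣p∣≡3⇒∣p-x-y∣≡1 : ∣ p ∣ ≡ 3 → ∣ p - x - y ∣ ≡ 1
    ∣p∣≡3⇒∣p-x-y∣≡1 ∣p∣≡3 = suc-injective (suc-injective (begin
      suc (suc ∣ p - x - y ∣) ≡⟨ cong suc (x∈p⇒∣p∣≡1+∣p-x∣ y∈p-x) ⟨
      suc ∣ p - x ∣           ≡⟨ x∈p⇒∣p∣≡1+∣p-x∣ x∈p ⟨
      ∣ p ∣                   ≡⟨ ∣p∣≡3 ⟩
      3                       ∎))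
      where open ≡-Reasoning

    ∣p∣≡3⇒p≡triple : ∣ p ∣ ≡ 3 → ∃ λ t → t ≢ x × t ≢ y × p ≡ triple x y t
    ∣p∣≡3⇒p≡triple ∣p∣≡3 with t , p-x-y≡⁅t⁆ ← ∣p∣≡1⇒p≡⁅x⁆ (∣p∣≡3⇒∣p-x-y∣≡1 ∣p∣≡3) =
      t , p-x-y≡⁅t⁆⇒p≡triple p-x-y≡⁅t⁆

open import Data.Vec.Membership.Propositional using (_∈_; _∉_)

record ThreeDistinct {A : Set} (P : A → Set) : Set where
  constructor three
  field
    {t₁ t₂ t₃} : A
    t₁≢t₂ : t₁ ≢ t₂
    t₁≢t₃ : t₁ ≢ t₃
    t₂≢t₃ : t₂ ≢ t₃
    p₁ : P t₁
    p₂ : P t₂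
    p₃ : P t₃

module _ {A B : Set} {P : A → Set} (g : A → B) where

  threeDistinct-from-image : (es : List B) → List.Unique es → 3 ≤ length es →
                             (∀ {e} → e List.∈ es → ∃ λ t → P t × e ≡ g t) → ThreeDistinct P
  threeDistinct-from-image (e₁ ∷ e₂ ∷ e₃ ∷ _)
    ((e₁≢e₂ ∷ e₁≢e₃ ∷ _) ∷ (e₂≢e₃ ∷ _) ∷ _) (s≤s (s≤s (s≤s _))) preimage
    with t₁ , p₁ , e₁≡gt₁ ← preimage (ListAny.here refl)
       | t₂ , p₂ , e₂≡gt₂ ← preimage (ListAny.there (ListAny.here refl))
       | t₃ , p₃ , e₃≡gt₃ ← preimage (ListAny.there (ListAny.there (ListAny.here refl)))
    = three (apart e₁≢e₂ e₁≡gt₁ e₂≡gt₂) (apart e₁≢e₃ e₁≡gt₁ e₃≡gt₃) (apart e₂≢e₃ e₂≡gt₂ e₃≡gt₃) p₁ p₂ p₃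
    where
    apart : ∀ {e e′ t t′} → e ≢ e′ → e ≡ g t → e′ ≡ g t′ → t ≢ t′
    apart e≢e′ e≡gt e′≡gt′ t≡t′ = e≢e′ (trans e≡gt (trans (cong g t≡t′) (sym e′≡gt′)))

module _ {A : Set} {P : A → Set} where

  threeDistinct-split : ∀ {Q : A → Set} → Decidable Q → ThreeDistinct P →
                        (∃ λ t → P t × ¬ Q t) ⊎ ThreeDistinct (λ t → P t × Q t)
  threeDistinct-split Q? (three t₁≢t₂ t₁≢t₃ t₂≢t₃ p₁ p₂ p₃) with Q? _ | Q? _ | Q? _
  ... | no ¬q₁ | _      | _      = inj₁ (_ , p₁ , ¬q₁)
  ... | yes _  | no ¬q₂ | _      = inj₁ (_ , p₂ , ¬q₂)
  ... | yes _  | yes _  | no ¬q₃ = inj₁ (_ , p₃ , ¬q₃)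
  ... | yes q₁ | yes q₂ | yes q₃ = inj₂ (three t₁≢t₂ t₁≢t₃ t₂≢t₃ (p₁ , q₁) (p₂ , q₂) (p₃ , q₃))

  threeDistinct-avoiding : DecidableEquality A → ThreeDistinct P → (a b : A) →
                           ∃ λ t → P t × t ≢ a × t ≢ b
  threeDistinct-avoiding _≟_ (three {t₁} {t₂} {t₃} t₁≢t₂ t₁≢t₃ t₂≢t₃ p₁ p₂ p₃) a b
    with t₁ ≟ a | t₁ ≟ b | t₂ ≟ a | t₂ ≟ b
  ... | no t₁≢a  | no t₁≢b  | _        | _        = t₁ , p₁ , t₁≢a , t₁≢b
  ... | yes refl | _        | _        | no t₂≢b  = t₂ , p₂ , ≢-sym t₁≢t₂ , t₂≢b
  ... | yes refl | _        | _        | yes refl = t₃ , p₃ , ≢-sym t₁≢t₃ , ≢-sym t₂≢t₃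
  ... | no _     | yes refl | no t₂≢a  | _        = t₂ , p₂ , t₂≢a , ≢-sym t₁≢t₂
  ... | no _     | yes refl | yes refl | _        = t₃ , p₃ , ≢-sym t₂≢t₃ , ≢-sym t₁≢t₃

∉⇒All≢ : ∀ {A : Set} {k} {x : A} {xs : Vec A k} → x ∉ xs → All (x ≢_) xs
∉⇒All≢ {xs = xs} x∉xs = lookup⁻ λ i x≡xsᵢ → x∉xs (subst (_∈ xs) (sym x≡xsᵢ) (∈-lookup i xs))

module _ {n : ℕ} where
  open import Data.Vec.Membership.DecPropositional (_≟_ {n}) using (_∈?_)

  short-vector-misses : ∀ {k} (xs : Vec (Fin n) k) → k < n → ¬ (∀ y → y ∈ xs)
  short-vector-misses xs k<n covers
    with i , j , i<j , same-index ← pigeonhole k<n (λ y → Any.index (covers y)) =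
    <⇒≢ i<j (trans (lookup-index (covers i))
                   (trans (cong (lookup xs) same-index) (sym (lookup-index (covers j)))))

  fresh : ∀ {k} (xs : Vec (Fin n) k) → k < n → ∃ λ y → All (y ≢_) xs
  fresh xs k<n with y , y∉xs ← ¬∀⟶∃¬ n (_∈ xs) (_∈? xs) (short-vector-misses xs k<n) = y , ∉⇒All≢ y∉xs

triple-swap₂₃ : ∀ {n} (a b c : Fin n) → triple a b c ≡ triple a c b
triple-swap₂₃ a b c = cong (⁅ a ⁆ ∪_) (∪-comm ⁅ b ⁆ ⁅ c ⁆)

module _ {n : ℕ} (H : ThreeGraph n) where
  open import Data.Vec.Membership.DecPropositional (_≟_ {n}) using (_∈?_)

  IsEdge-swap₂₃ : ∀ {a b c} → IsEdge H a b c → IsEdge H a c b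
  IsEdge-swap₂₃ {a} {b} {c} = subst (List._∈ edges H) (triple-swap₂₃ a b c)

  Link : Fin n → Fin n → Fin n → Set
  Link x y t = t ≢ x × t ≢ y × IsEdge H x y t

  δ₂≥3⇒threeDistinctLink : δ₂≥ H 3 → ∀ {x y} → x ≢ y → ThreeDistinct (Link x y)
  δ₂≥3⇒threeDistinctLink δ {x} {y} x≢y =
    threeDistinct-from-image (triple x y) (filter xy∈? (edges H)) (filter⁺ xy∈? (unique H))
                             (δ x y x≢y) preimage
    where
    xy∈? = λ e → (x ∈ₛ? e) ×-dec (y ∈ₛ? e)
    preimage : ∀ {e} → e List.∈ filter xy∈? (edges H) → ∃ λ t → Link x y t × e ≡ triple x y t
    preimage e∈xyEdges
      with e∈edges , x∈e , y∈e ← ∈-filter⁻ xy∈? e∈xyEdges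
      with t , t≢x , t≢y , e≡xyt ← ∣p∣≡3⇒p≡triple x∈e y∈e x≢y (ListAll.lookup (uniform H) e∈edges)
      = t , (t≢x , t≢y , subst (List._∈ edges H) e≡xyt e∈edges) , e≡xyt

  LinearPath₃ : Fin n → Set
  LinearPath₃ u =
    Σ (Fin n) λ v₁ → Σ (Fin n) λ v₂ → Σ (Fin n) λ v₃ →
    Σ (Fin n) λ v₄ → Σ (Fin n) λ v₅ → Σ (Fin n) λ v₆ →
      Unique (u ∷ v₁ ∷ v₂ ∷ v₃ ∷ v₄ ∷ v₅ ∷ v₆ ∷ []) ×
      IsEdge H u v₁ v₂ × IsEdge H u v₃ v₄ × IsEdge H v₄ v₅ v₆

  record LinearPath₂ (u : Fin n) : Set where
    field
      {v₃ v₄ v₅ v₆} : Fin n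
      distinct : Unique (u ∷ v₃ ∷ v₄ ∷ v₅ ∷ v₆ ∷ [])
      edge₁ : IsEdge H u v₃ v₄
      edge₂ : IsEdge H v₄ v₅ v₆

    vertices : Vec (Fin n) 4
    vertices = v₃ ∷ v₄ ∷ v₅ ∷ v₆ ∷ []

  open LinearPath₂

  extend : ∀ {u} (P : LinearPath₂ u) {v₁ v₂} →
           All (v₁ ≢_) (u ∷ vertices P) → All (v₂ ≢_) (u ∷ vertices P) →
           v₁ ≢ v₂ → IsEdge H u v₁ v₂ → LinearPath₃ u
  extend P (v₁≢u ∷ v₁∉P) (v₂≢u ∷ v₂∉P) v₁≢v₂ uv₁v₂ with u∉P ∷ P-distinct ← distinct P =
    _ , _ , _ , _ , _ , _ ,
    ((≢-sym v₁≢u ∷ ≢-sym v₂≢u ∷ u∉P) ∷ (v₁≢v₂ ∷ v₁∉P) ∷ v₂∉P ∷ P-distinct) ,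
    uv₁v₂ , edge₁ P , edge₂ P

  module _ (δ : δ₂≥ H 3) where

    link-avoiding : ∀ {x y} → x ≢ y → (a b : Fin n) → ∃ λ t → Link x y t × t ≢ a × t ≢ b
    link-avoiding x≢y = threeDistinct-avoiding _≟_ (δ₂≥3⇒threeDistinctLink δ x≢y)

    linearPath₂ : 3 ≤ n → ∀ u → LinearPath₂ u
    linearPath₂ 3≤n u
      with a , a≢u ∷ [] ← fresh (u ∷ []) (≤-trans (m≤m+n 2 1) 3≤n)
      with b , b≢u ∷ b≢a ∷ [] ← fresh (u ∷ a ∷ []) 3≤n
      with c , (c≢a , c≢b , abc) , c≢u , _ ← link-avoiding (≢-sym b≢a) u u
      with d , (d≢u , d≢a , uad) , d≢b , d≢c ← link-avoiding (≢-sym a≢u) b c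
      = record
        { distinct = (≢-sym d≢u ∷ ≢-sym a≢u ∷ ≢-sym b≢u ∷ ≢-sym c≢u ∷ [])
                   ∷ (d≢a ∷ d≢b ∷ d≢c ∷ []) ∷ (≢-sym b≢a ∷ ≢-sym c≢a ∷ []) ∷ (≢-sym c≢b ∷ []) ∷ [] ∷ []
        ; edge₁ = IsEdge-swap₂₃ uad
        ; edge₂ = abc
        }

    linksInside⇒linearPath₃ :
      ∀ {k u e₁ e₂ e₃} (W : Vec (Fin n) k) →
      All (e₁ ≢_) (u ∷ W) → All (e₂ ≢_) (e₃ ∷ e₁ ∷ u ∷ W) → All (e₃ ≢_) (e₁ ∷ u ∷ W) →
      ThreeDistinct (λ t → Link u e₁ t × t ∈ W) → ThreeDistinct (λ t → Link u e₃ t × t ∈ W) →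
      LinearPath₃ u
    linksInside⇒linearPath₃ {u = u} {e₁} {e₂} {e₃} W
      (e₁≢u ∷ e₁∉W) (e₂≢e₃ ∷ e₂≢e₁ ∷ e₂≢u ∷ e₂∉W) (e₃≢e₁ ∷ e₃≢u ∷ e₃∉W) X₁ X₃
      with t , (t≢e₁ , t≢e₂ , e₁e₂t) , t≢u , t≢e₃ ← link-avoiding (≢-sym e₂≢e₁) u e₃
      with x , ((x≢u , x≢e₁ , ue₁x) , x∈W) , x≢t , _ ← threeDistinct-avoiding _≟_ X₁ t t
      with y , ((y≢u , y≢e₃ , ue₃y) , y∈W) , y≢t , y≢x ← threeDistinct-avoiding _≟_ X₃ t x
      = extend P
          (e₃≢u ∷ All.lookup e₃∉W x∈W ∷ e₃≢e₁ ∷ ≢-sym e₂≢e₃ ∷ ≢-sym t≢e₃ ∷ [])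
          (y≢u ∷ y≢x ∷ ≢-sym (All.lookup e₁∉W y∈W) ∷ ≢-sym (All.lookup e₂∉W y∈W) ∷ y≢t ∷ [])
          (≢-sym y≢e₃) ue₃y
      where
      P : LinearPath₂ u
      P = record
        { distinct = (≢-sym x≢u ∷ ≢-sym e₁≢u ∷ ≢-sym e₂≢u ∷ ≢-sym t≢u ∷ [])
                   ∷ (x≢e₁ ∷ ≢-sym (All.lookup e₂∉W x∈W) ∷ x≢t ∷ []) ∷ (≢-sym e₂≢e₁ ∷ ≢-sym t≢e₁ ∷ [])
                   ∷ (≢-sym t≢e₂ ∷ []) ∷ [] ∷ []
        ; edge₁ = IsEdge-swap₂₃ ue₁x
        ; edge₂ = e₁e₂t
        }

    linearPath₂⇒linearPath₃ : 8 ≤ n → ∀ {u} → LinearPath₂ u → LinearPath₃ u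
    linearPath₂⇒linearPath₃ 8≤n {u} P
      with e₁ , e₁∉@(e₁≢u ∷ _) ← fresh (u ∷ vertices P) (≤-trans (m≤m+n 6 2) 8≤n)
      with e₃ , e₃∉@(_ ∷ e₃∉′@(e₃≢u ∷ _)) ← fresh (e₁ ∷ u ∷ vertices P) (≤-trans (m≤m+n 7 1) 8≤n)
      with e₂ , e₂∉ ← fresh (e₃ ∷ e₁ ∷ u ∷ vertices P) 8≤n
      with threeDistinct-split (_∈? vertices P) (δ₂≥3⇒threeDistinctLink δ (≢-sym e₁≢u))
         | threeDistinct-split (_∈? vertices P) (δ₂≥3⇒threeDistinctLink δ (≢-sym e₃≢u))
    ... | inj₁ (t , (t≢u , t≢e₁ , ue₁t) , t∉P) | _ = extend P e₁∉ (t≢u ∷ ∉⇒All≢ t∉P) (≢-sym t≢e₁) ue₁t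
    ... | _ | inj₁ (t , (t≢u , t≢e₃ , ue₃t) , t∉P) = extend P e₃∉′ (t≢u ∷ ∉⇒All≢ t∉P) (≢-sym t≢e₃) ue₃t
    ... | inj₂ X₁ | inj₂ X₃ = linksInside⇒linearPath₃ (vertices P) e₁∉ e₂∉ e₃∉ X₁ X₃

theorem11 : (n : ℕ) → n ≥ 8 → (H : ThreeGraph n) → δ₂≥ H 3 →
    (u : Fin n) →
    Σ (Fin n) λ v₁ → Σ (Fin n) λ v₂ → Σ (Fin n) λ v₃ →
    Σ (Fin n) λ v₄ → Σ (Fin n) λ v₅ → Σ (Fin n) λ v₆ →
      Unique (u ∷ v₁ ∷ v₂ ∷ v₃ ∷ v₄ ∷ v₅ ∷ v₆ ∷ []) ×
      IsEdge H u v₁ v₂ × IsEdge H u v₃ v₄ × IsEdge H v₄ v₅ v₆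
theorem11 n n≥8 H δ u =
  linearPath₂⇒linearPath₃ H δ n≥8 (linearPath₂ H δ (≤-trans (m≤m+n 3 5) n≥8) u)
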